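{- Let $r\ge 2$ and let $\mathcal{H}$ be an $r$-uniform hypergraph that contains no Berge path of length $r+1$ and no Berge cycle of length $r+1$. Let $v_1,h_1,v_2,\dots,h_r,v_{r+1}$ be a Berge path of length $r$ in $\mathcal{H}$. Then every hyperedge of $\mathcal{H}$ containing $v_1$ or $v_{r+1}$ is one of $h_1,\dots,h_r$.
   Context: An $r$-uniform hypergraph has hyperedges that are distinct $r$-element subsets of its vertex set. A Berge path of length $k$ is a collection of $k$ distinct hyperedges $h_1,\dots,h_k$ and $k+1$ distinct vertices $v_1,\dots,v_{k+1}$ with $v_i,v_{i+1}\in h_i$ for all $1\le i\le k$; the $v_i$ are the defining vertices, the $h_i$ the defining hyperedges, and $v_1,v_{k+1}$ the endpoints. A Berge cycle of length $k$ is an alternating sequence $v_1,h_1,v_2,h_2,\dots,v_k,h_k,v_1$ of distinct vertices $v_i$ and distinct hyperedges $h_i$ with $v_i,v_{i+1}\in h_i$ for $1\le i\le k-1$ and $v_k,v_1\in h_k$. -}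

module Defs where

open import Data.Nat using (ℕ)
import Data.Nat as ℕ
open import Data.Fin using (Fin; zero; suc; inject₁; fromℕ)
open import Data.Fin.Subset using (Subset; _∈_; ∣_∣)
open import Data.Product using (Σ; _×_)
open import Function.Definitions using (Injective)
open import Relation.Binary.PropositionalEquality using (_≡_)

-- Hyperedges are subsets, hence automatically distinct.
record UniformHypergraph (n r : ℕ) : Set₁ where
  field
    IsEdge  : Subset n → Set
    uniform : ∀ e → IsEdge e → ∣ e ∣ ≡ r
open UniformHypergraph public

record BergePath {n r : ℕ} (H : UniformHypergraph n r) (k : ℕ) : Set where
  field
    v      : Fin (ℕ.suc k) → Fin n
    h      : Fin k → Subset n
    v-inj  : Injective _≡_ _≡_ v
    h-inj  : Injective _≡_ _≡_ h
    h-edge : ∀ i → IsEdge H (h i)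
    v-in-h : ∀ i → (v (inject₁ i) ∈ h i) × (v (suc i) ∈ h i)
open BergePath public

-- Stated for length suc k (length-0 cycles are
-- not meaningful); vertices indexed by Fin (ℕ.suc k).
record BergeCycle {n r : ℕ} (H : UniformHypergraph n r) (k : ℕ) : Set where
  field
    v      : Fin (ℕ.suc k) → Fin n
    h      : Fin (ℕ.suc k) → Subset n
    v-inj  : Injective _≡_ _≡_ v
    h-inj  : Injective _≡_ _≡_ h
    h-edge : ∀ i → IsEdge H (h i)
    v-in-h : ∀ (i : Fin k) → (v (inject₁ i) ∈ h (inject₁ i)) × (v (suc i) ∈ h (inject₁ i))
    close  : (v (fromℕ k) ∈ h (fromℕ k)) × (v zero ∈ h (fromℕ k))
open BergeCycle public

{-# OPTIONS --safe #-}
module Submission where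

-- Let e be an edge through the first vertex v₀ of the path that is not one of its edges.
-- Every vertex of e lies on the path (otherwise prepending it and e gives a longer path)
-- and is not the last vertex (otherwise e closes a cycle of length r + 1); since |e| = r,
-- e is exactly {v₀, …, v_{r-1}}.  For r ≥ 2 this contains v₁, so replacing h₀ by e gives
-- a Berge path on the same vertices for which h₀ is such an edge through v₀; hence
-- h₀ = {v₀, …, v_{r-1}} = e, a contradiction.  Reversing the path handles the last vertex.

open import Defs
open import Data.Bool.Properties using () renaming (_≟_ to _≟ᵇ_)
open import Data.Fin using (Fin; zero; suc; fromℕ; inject₁; opposite; _≟_)
open import Data.Fin.Properties
  using (any?; 0≢1+n; fromℕ≢inject₁; inject₁-injective; suc-injective; opposite-involutive)
open import Data.Fin.Subset using (Subset; _∈_; _⊆_; _∪_; ⁅_⁆; ⊥; ∣_∣; inside; outside)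
open import Data.Fin.Subset.Properties
  using (_∈?_; ⊆-antisym; p⊂q⇒∣p∣<∣q∣; ∣⊥∣≡0; ∣⁅x⁆∣≡1; ∣p∣≤∣x∷p∣; x∈⁅x⁆; x∈p∪q⁺)
open import Data.Nat using (ℕ; zero; suc; _≤_; _+_; z≤n; s≤s)
open import Data.Nat.Properties using (≤-trans; ≤-reflexive; +-suc; +-mono-≤; +-monoʳ-≤; <⇒≱)
open import Data.Product using (∃; _,_; proj₁; proj₂; map)
open import Data.Sum using (_⊎_; inj₁; inj₂)
import Data.Vec.Base as Vec
open import Data.Vec.Functional using (_∷_; init)
open import Data.Vec.Properties using (≡-dec)
open import Function using (_∘_; id)
open import Function.Definitions using (Injective)
open import Relation.Binary.Definitions using (DecidableEquality)
open import Relation.Binary.PropositionalEquality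
  using (_≡_; _≢_; refl; sym; trans; cong; subst)
open import Relation.Nullary using (¬_; yes; no; contradiction)

∣p∪q∣≤∣p∣+∣q∣ : ∀ {n} (p q : Subset n) → ∣ p ∪ q ∣ ≤ ∣ p ∣ + ∣ q ∣
∣p∪q∣≤∣p∣+∣q∣ Vec.[]              Vec.[]             = z≤n
∣p∪q∣≤∣p∣+∣q∣ (outside Vec.∷ p) (outside Vec.∷ q) = ∣p∪q∣≤∣p∣+∣q∣ p q
∣p∪q∣≤∣p∣+∣q∣ (outside Vec.∷ p) (inside Vec.∷ q) =
  ≤-trans (s≤s (∣p∪q∣≤∣p∣+∣q∣ p q)) (≤-reflexive (sym (+-suc ∣ p ∣ ∣ q ∣)))
∣p∪q∣≤∣p∣+∣q∣ (inside Vec.∷ p)  (x Vec.∷ q) =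
  s≤s (≤-trans (∣p∪q∣≤∣p∣+∣q∣ p q) (+-monoʳ-≤ ∣ p ∣ (∣p∣≤∣x∷p∣ x q)))

p⊆q∧∣q∣≤∣p∣⇒p≡q : ∀ {n} {p q : Subset n} → p ⊆ q → ∣ q ∣ ≤ ∣ p ∣ → p ≡ q
p⊆q∧∣q∣≤∣p∣⇒p≡q {p = p} p⊆q ∣q∣≤∣p∣ = ⊆-antisym p⊆q q⊆p
  where
  q⊆p : _ ⊆ p
  q⊆p {x} x∈q with x ∈? p
  ... | yes x∈p = x∈p
  ... | no  x∉p = contradiction ∣q∣≤∣p∣ (<⇒≱ (p⊂q⇒∣p∣<∣q∣ (p⊆q , x , x∈q , x∉p)))

_≟ˢ_ : ∀ {n} → DecidableEquality (Subset n)
_≟ˢ_ = ≡-dec _≟ᵇ_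

image : ∀ {m n} → (Fin m → Fin n) → Subset n
image {zero}  g = ⊥
image {suc m} g = ⁅ g zero ⁆ ∪ image (g ∘ suc)

∈-image : ∀ {m n} (g : Fin m → Fin n) i → g i ∈ image g
∈-image g zero    = x∈p∪q⁺ (inj₁ (x∈⁅x⁆ (g zero)))
∈-image g (suc i) = x∈p∪q⁺ (inj₂ (∈-image (g ∘ suc) i))

∣image∣≤m : ∀ {m n} (g : Fin m → Fin n) → ∣ image g ∣ ≤ m
∣image∣≤m {zero}  {n} g = ≤-reflexive (∣⊥∣≡0 n)
∣image∣≤m {suc m}     g = ≤-trans (∣p∪q∣≤∣p∣+∣q∣ ⁅ g zero ⁆ (image (g ∘ suc)))
  (+-mono-≤ (≤-reflexive (∣⁅x⁆∣≡1 (g zero))) (∣image∣≤m (g ∘ suc)))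

Injective-∷ : ∀ {A : Set} {m} {x : A} {xs : Fin m → A}
  → Injective _≡_ _≡_ xs → (∀ i → xs i ≢ x) → Injective _≡_ _≡_ (x ∷ xs)
Injective-∷ inj fresh {zero}  {zero}  _  = refl
Injective-∷ inj fresh {zero}  {suc j} eq = contradiction (sym eq) (fresh j)
Injective-∷ inj fresh {suc i} {zero}  eq = contradiction eq (fresh i)
Injective-∷ inj fresh {suc i} {suc j} eq = cong suc (inj eq)

data InjectOrLast {m : ℕ} : Fin (suc m) → Set where
  inject : (i : Fin m) → InjectOrLast (inject₁ i)
  last   : InjectOrLast (fromℕ m)

injectOrLast : ∀ {m} (j : Fin (suc m)) → InjectOrLast j
injectOrLast {zero}  zero    = last
injectOrLast {suc m} zero    = inject zero
injectOrLast {suc m} (suc j) with injectOrLast j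
... | inject i = inject (suc i)
... | last     = last

opposite-inject₁ : ∀ {m} (i : Fin m) → opposite (inject₁ i) ≡ suc (opposite i)
opposite-inject₁ {suc m} zero    = refl
opposite-inject₁ {suc m} (suc i) = cong inject₁ (opposite-inject₁ i)

opposite-injective : ∀ {m} {i j : Fin m} → opposite i ≡ opposite j → i ≡ j
opposite-injective {i = i} {j} eq =
  trans (sym (opposite-involutive i)) (trans (cong opposite eq) (opposite-involutive j))

module _ {n r : ℕ} {H : UniformHypergraph n r} where

  reverse : ∀ {k} → BergePath H k → BergePath H k
  reverse P = record
    { v      = v P ∘ opposite
    ; h      = h P ∘ opposite
    ; v-inj  = opposite-injective ∘ v-inj P
    ; h-inj  = opposite-injective ∘ h-inj P
    ; h-edge = h-edge P ∘ opposite
    ; v-in-h = λ i → subst (λ j → v P j ∈ h P (opposite i)) (sym (opposite-inject₁ i))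
                           (proj₂ (v-in-h P (opposite i)))
                   , proj₁ (v-in-h P (opposite i))
    }

  extendAtStart : ∀ {k} (P : BergePath H k) {e : Subset n} → IsEdge H e
    → (∀ i → h P i ≢ e) → v P zero ∈ e
    → ∀ {u} → u ∈ e → (∀ j → v P j ≢ u) → BergePath H (suc k)
  extendAtStart P {e} e-edge e-new v₀∈e {u} u∈e u-new = record
    { v      = u ∷ v P
    ; h      = e ∷ h P
    ; v-inj  = Injective-∷ (v-inj P) u-new
    ; h-inj  = Injective-∷ (h-inj P) e-new
    ; h-edge = λ { zero → e-edge ; (suc i) → h-edge P i }
    ; v-in-h = λ { zero → u∈e , v₀∈e ; (suc i) → v-in-h P i }
    }

  -- The cycle starts at the last vertex: v_last, e, v₀, h₀, v₁, …, h_last.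
  closeToCycle : ∀ {k} (P : BergePath H (suc k)) {e : Subset n} → IsEdge H e
    → (∀ i → h P i ≢ e) → v P (fromℕ (suc k)) ∈ e → v P zero ∈ e → BergeCycle H (suc k)
  closeToCycle {k} P {e} e-edge e-new last∈e v₀∈e = record
    { v      = v P (fromℕ (suc k)) ∷ init (v P)
    ; h      = e ∷ h P
    ; v-inj  = Injective-∷ (inject₁-injective ∘ v-inj P) (λ i → fromℕ≢inject₁ ∘ sym ∘ v-inj P)
    ; h-inj  = Injective-∷ (h-inj P) e-new
    ; h-edge = λ { zero → e-edge ; (suc i) → h-edge P i }
    ; v-in-h = λ { zero → last∈e , v₀∈e ; (suc i) → v-in-h P (inject₁ i) }
    ; close  = v-in-h P (fromℕ k)
    }

  replaceFirstEdge : ∀ {k} (P : BergePath H (suc k)) {e : Subset n} → IsEdge H e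
    → (∀ i → h P (suc i) ≢ e) → v P zero ∈ e → v P (suc zero) ∈ e → BergePath H (suc k)
  replaceFirstEdge P {e} e-edge e-new v₀∈e v₁∈e = record
    { v      = v P
    ; h      = e ∷ (h P ∘ suc)
    ; v-inj  = v-inj P
    ; h-inj  = Injective-∷ (suc-injective ∘ h-inj P) e-new
    ; h-edge = λ { zero → e-edge ; (suc i) → h-edge P (suc i) }
    ; v-in-h = λ { zero → v₀∈e , v₁∈e ; (suc i) → v-in-h P (suc i) }
    }

module _ {n m : ℕ} {H : UniformHypergraph n (suc m)}
         (noLongerPath : ¬ BergePath H (suc (suc m))) (noCycle : ¬ BergeCycle H (suc m)) where

  newEdgeAtStart≡image-init : (P : BergePath H (suc m)) {e : Subset n} → IsEdge H e
    → (∀ i → h P i ≢ e) → v P zero ∈ e → e ≡ image (init (v P))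
  newEdgeAtStart≡image-init P {e} e-edge e-new v₀∈e = p⊆q∧∣q∣≤∣p∣⇒p≡q e⊆image
    (≤-trans (∣image∣≤m (init (v P))) (≤-reflexive (sym (uniform H e e-edge))))
    where
    e⊆image : e ⊆ image (init (v P))
    e⊆image {u} u∈e with any? (λ j → v P j ≟ u)
    ... | no u∉P = contradiction
      (extendAtStart P e-edge e-new v₀∈e u∈e (λ j eq → u∉P (j , eq))) noLongerPath
    ... | yes (j , refl) with injectOrLast j
    ...   | inject i = ∈-image (init (v P)) i
    ...   | last     = contradiction (closeToCycle P e-edge e-new u∈e v₀∈e) noCycle

module _ {n m : ℕ} {H : UniformHypergraph n (suc (suc m))}
         (noLongerPath : ¬ BergePath H (suc (suc (suc m)))) (noCycle : ¬ BergeCycle H (suc (suc m))) where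

  newEdgeAtStart-impossible : (P : BergePath H (suc (suc m))) {e : Subset n} → IsEdge H e
    → v P zero ∈ e → ¬ (∀ i → h P i ≢ e)
  newEdgeAtStart-impossible P {e} e-edge v₀∈e e-new = e-new zero (trans h₀≡init (sym e≡init))
    where
    e≡init : e ≡ image (init (v P))
    e≡init = newEdgeAtStart≡image-init noLongerPath noCycle P e-edge e-new v₀∈e
    v₁∈e : v P (suc zero) ∈ e
    v₁∈e = subst (v P (suc zero) ∈_) (sym e≡init) (∈-image (init (v P)) (suc zero))
    Q : BergePath H (suc (suc m))
    Q = replaceFirstEdge P e-edge (e-new ∘ suc) v₀∈e v₁∈e
    h₀-new : ∀ i → h Q i ≢ h P zero
    h₀-new zero    = e-new zero ∘ sym
    h₀-new (suc i) = 0≢1+n ∘ sym ∘ h-inj P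
    h₀≡init : h P zero ≡ image (init (v P))
    h₀≡init = newEdgeAtStart≡image-init noLongerPath noCycle Q (h-edge P zero) h₀-new
      (proj₁ (v-in-h P zero))

  edgeAtStart-isPathEdge : (P : BergePath H (suc (suc m))) {e : Subset n} → IsEdge H e
    → v P zero ∈ e → ∃ λ i → e ≡ h P i
  edgeAtStart-isPathEdge P {e} e-edge v₀∈e with any? (λ i → e ≟ˢ h P i)
  ... | yes e∈P = e∈P
  ... | no  e∉P = contradiction (λ i eq → e∉P (i , sym eq))
    (newEdgeAtStart-impossible P e-edge v₀∈e)

lemma2p1 : ∀ {n r : ℕ} → 2 ≤ r → (H : UniformHypergraph n r)
    → ¬ BergePath H (suc r) → ¬ BergeCycle H r
    → (P : BergePath H r) → (e : Subset n) → IsEdge H e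
    → (v P zero ∈ e ⊎ v P (fromℕ r) ∈ e)
    → ∃ λ (i : Fin r) → e ≡ h P i
lemma2p1 (s≤s (s≤s _)) H noLongerPath noCycle P e e-edge (inj₁ v₀∈e) =
  edgeAtStart-isPathEdge noLongerPath noCycle P e-edge v₀∈e
lemma2p1 (s≤s (s≤s _)) H noLongerPath noCycle P e e-edge (inj₂ vᵣ∈e) =
  map opposite id (edgeAtStart-isPathEdge noLongerPath noCycle (reverse P) e-edge vᵣ∈e)
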